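{- Let $G$ be a finite connected even graph, let $\mathcal{C}$ be a cycle decomposition of $G$, and let $CI(G)$ be the cycle intersection graph of $G$ with respect to $\mathcal{C}$. If $CI(G)$ is a tree, then $\nabla(G)\leq |MSF(CI(G))|$.
   Context: An even graph is a graph in which every vertex has even degree (multiple edges are allowed). A cycle decomposition of $G$ is a collection of cycles of $G$ whose edge sets partition $E(G)$. The cycle intersection graph $CI(G)$ with respect to $\mathcal{C}$ is the (multi)graph with vertex set $\mathcal{C}$ having, for each pair of distinct cycles $C,C'\in\mathcal{C}$ and each vertex $v\in V(C)\cap V(C')$, one edge joining $C$ and $C'$. For a graph $H$, the size of a spanning forest $F$ of $H$ (a spanning acyclic subgraph) is $|E(F)|$ plus the number of vertices of degree $0$ in $F$; $MSF(H)$ denotes a spanning forest of $H$ of minimum size, and $|MSF(H)|$ its size. A decycling set of $G$ is a set $S\subseteq V(G)$ with $G\setminus S$ acyclic; $\nabla(G)$ is the minimum size of a decycling set. -}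

module Defs where

open import Data.Nat using (ℕ; zero; suc; _+_; _≤_; _<ᵇ_)
open import Data.Nat.Divisibility using (_∣_)
open import Data.Bool using (Bool; true; false; if_then_else_; _∧_)
open import Data.Fin using (Fin; zero; suc; fromℕ; inject₁; toℕ; _≟_)
open import Data.Fin.Properties using (any?)
open import Data.Fin.Subset using (Subset; _∈_; ∣_∣)
open import Data.Fin.Subset.Properties using (_∈?_)
open import Data.Nat.ListAction using (sum)
open import Data.List using (List; length; lookup; map; filterᵇ; allFin; concatMap)
open import Data.Product using (Σ; ∃; _×_; _,_; proj₁; proj₂)
open import Data.Sum using (_⊎_)
open import Data.Empty using (⊥)
open import Relation.Nullary using (¬_; does)
open import Relation.Binary.PropositionalEquality using (_≡_; _≢_)
open import Relation.Binary.Construct.Closure.ReflexiveTransitive using (Star)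
open import Function.Definitions using (Injective)

-- Finite multigraphs: vertices Fin V, edges a list of (unordered) vertex
-- pairs; an edge is identified by its position in the list, so parallel
-- edges are allowed.

record Graph : Set where
  constructor graph
  field
    V : ℕ
    E : List (Fin V × Fin V)

open Graph public

Edge : Graph → Set
Edge G = Fin (length (E G))

ends : (G : Graph) → Edge G → Fin (V G) × Fin (V G)
ends G e = lookup (E G) e

Joins : (G : Graph) → Edge G → Fin (V G) → Fin (V G) → Set
Joins G e u v = ends G e ≡ (u , v) ⊎ ends G e ≡ (v , u)

Loopless : Graph → Set
Loopless G = (e : Edge G) → proj₁ (ends G e) ≢ proj₂ (ends G e)

deg : (G : Graph) → Fin (V G) → ℕ
deg G v = sum (map (λ p → (if does (proj₁ p ≟ v) then 1 else 0)
                        + (if does (proj₂ p ≟ v) then 1 else 0)) (E G))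

Even : Graph → Set
Even G = (v : Fin (V G)) → 2 ∣ deg G v

Adj : (G : Graph) → Fin (V G) → Fin (V G) → Set
Adj G u v = ∃ λ (e : Edge G) → Joins G e u v

Connected : Graph → Set
Connected G = (u v : Fin (V G)) → Star (Adj G) u v

record Cycle (G : Graph) : Set where
  field
    k      : ℕ
    k≥1    : 1 ≤ k
    vs     : Fin (suc k) → Fin (V G)
    es     : Fin (suc k) → Edge G
    vs-inj : Injective _≡_ _≡_ vs
    es-inj : Injective _≡_ _≡_ es
    step   : (i : Fin k) → Joins G (es (inject₁ i)) (vs (inject₁ i)) (vs (suc i))
    close  : Joins G (es (fromℕ k)) (vs (fromℕ k)) (vs zero)

open Cycle public

_∈V_ : {G : Graph} → Fin (V G) → Cycle G → Set
v ∈V C = ∃ λ i → vs C i ≡ v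

_∈E_ : {G : Graph} → Edge G → Cycle G → Set
e ∈E C = ∃ λ i → es C i ≡ e

Acyclic : Graph → Set
Acyclic G = Cycle G → ⊥

Tree : Graph → Set
Tree G = Connected G × Acyclic G

record CycleDecomposition (G : Graph) : Set where
  field
    c      : ℕ
    cyc    : Fin c → Cycle G
    cover  : (e : Edge G) → ∃ λ i → e ∈E cyc i
    unique : (e : Edge G) (i j : Fin c) → e ∈E cyc i → e ∈E cyc j → i ≡ j

open CycleDecomposition public

-- Cycle intersection graph: vertex set = the cycles (indices Fin c);
-- for each pair i < j and each vertex v ∈ V(C_i) ∩ V(C_j), one edge ij.

inCycleᵇ : {G : Graph} → Fin (V G) → Cycle G → Bool
inCycleᵇ v C = does (any? (λ i → vs C i ≟ v))

CI : (G : Graph) → CycleDecomposition G → Graph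
CI G 𝒞 = graph (c 𝒞) (concatMap pairEdges (allFin (c 𝒞)))
  where
    pairEdges : Fin (c 𝒞) → List (Fin (c 𝒞) × Fin (c 𝒞))
    pairEdges i = concatMap
      (λ j → map (λ _ → (i , j))
        (filterᵇ (λ v → (toℕ i <ᵇ toℕ j) ∧ inCycleᵇ v (cyc 𝒞 i) ∧ inCycleᵇ v (cyc 𝒞 j))
                 (allFin (V G))))
      (allFin (c 𝒞))

spanningSub : (H : Graph) → Subset (length (E H)) → Graph
spanningSub H S = graph (V H) (map (ends H) (filterᵇ (λ e → does (e ∈? S)) (allFin (length (E H)))))

SpanningForest : (H : Graph) → Subset (length (E H)) → Set
SpanningForest H S = Acyclic (spanningSub H S)

isolatedCount : Graph → ℕ
isolatedCount F = length (filterᵇ (λ v → does (deg F v Data.Nat.≟ 0)) (allFin (V F)))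

forestSize : Graph → ℕ
forestSize F = length (E F) + isolatedCount F

IsMSFSize : Graph → ℕ → Set
IsMSFSize H m =
  (∃ λ S → SpanningForest H S × forestSize (spanningSub H S) ≡ m)
  × (∀ S → SpanningForest H S → m ≤ forestSize (spanningSub H S))

-- Decycling sets: G \ S is acyclic, i.e. every cycle of G meets S
-- (the cycles of G \ S are exactly the cycles of G avoiding S).

Decycling : (G : Graph) → Subset (V G) → Set
Decycling G S = (C : Cycle G) → ∃ λ i → vs C i ∈ S

IsDecyclingNumber : Graph → ℕ → Set
IsDecyclingNumber G m =
  (∃ λ S → Decycling G S × ∣ S ∣ ≡ m)
  × (∀ S → Decycling G S → m ≤ ∣ S ∣)

{-# OPTIONS --safe #-}
module Submission where

-- Colour each edge of G by the cycle of 𝒞 containing it. Going around a cycle C of G, a change of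
-- colour at a vertex v of C is an edge of CI labelled v, and distinct vertices give distinct edges,
-- so the colours seen along C form a closed trail in CI. A closed trail that ever moves contains a
-- cycle, so when CI is acyclic all edges of C lie in a single cycle C_a of 𝒞, and then C = C_a.
-- Hence a vertex set meeting every cycle of 𝒞 is decycling. From any spanning subgraph F of CI we
-- get one of size at most |E(F)| + #(isolated vertices of F): the labels of the edges of F plus a
-- vertex of C_a for each isolated a. So only the acyclicity of CI and the looplessness of G are
-- used.

open import Defs
open import Data.Bool using (Bool; true; false; T; _∧_)
open import Data.Bool.Properties using (T-∧; T-≡)
open import Data.Empty using (⊥-elim)
open import Data.Fin using (Fin; zero; suc; toℕ; fromℕ; inject₁; cast; _≟_)
open import Data.Fin.Properties
  using (cast-involutive; toℕ-injective; toℕ<n; toℕ-fromℕ; toℕ-inject₁)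
import Data.Fin.Properties as Finₚ
open import Data.Fin.Relation.Unary.Top using (view; ‵fromℕ; ‵inj₁; view-fromℕ; view-inject₁)
open import Data.Fin.Subset using (Subset; ⁅_⁆; _∪_; ⋃; ∣_∣) renaming (_∈_ to _∈ₛ_)
open import Data.Fin.Subset.Properties using (_∈?_; ∣⊥∣≡0; ∣⁅x⁆∣≡1; ∣p∣≤∣x∷p∣; x∈⁅x⁆; x∈p∪q⁺)
open import Data.List using (List; []; _∷_; _++_; length; lookup; map; filterᵇ; allFin; concatMap)
open import Data.List.Properties using (length-map; length-++; map-concatMap; concatMap-cong; map-∘)
open import Data.List.Membership.Propositional using (_∈_; lose)
open import Data.List.Membership.Propositional.Properties
  using (∈-lookup; ∈-++⁺ˡ; ∈-++⁺ʳ; ∈-concatMap⁺; ∈-concatMap⁻; ∈-map⁺; ∈-map⁻; ∈-filter⁺; ∈-filter⁻; ∈-allFin)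
open import Data.List.Relation.Unary.Any using (here; there; satisfied; index)
open import Data.List.Relation.Unary.Any.Properties using (lookup-index)
import Data.Nat as ℕ
open import Data.Nat using (ℕ; zero; suc; _+_; _∸_; _≤_; _<_; _<ᵇ_; z≤n; s≤s; z<s)
open import Data.Nat.GeneralisedArithmetic using (fold; fold-+)
open import Data.Nat.Induction using (<-rec)
open import Data.Nat.Properties
  using (≤-refl; ≤-reflexive; ≤-trans; ≤-pred; <⇒≤; <-irrefl; <-trans; ≤-<-trans; <-cmp; <⇒<ᵇ;
         +-suc; +-monoʳ-≤; +-monoˡ-<; +-cancelʳ-≡; m∸n≤m; m∸n+n≡m; m<n⇒0<n∸m; 1+n≢n; suc-injective;
         anyUpTo?; module ≤-Reasoning)
open import Data.Product using (Σ; ∃; _×_; _,_; proj₁; proj₂; uncurry)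
open import Data.Sum using (_⊎_; inj₁; inj₂)
open import Data.Vec using ([]; _∷_)
open import Function using (_∘_; Equivalence)
open import Relation.Binary.Definitions using (tri<; tri≈; tri>)
open import Relation.Binary.PropositionalEquality
open import Relation.Nullary using (Dec; does; contradiction; yes; no)
open import Relation.Nullary.Decidable using (T?; dec-true)

private
  variable
    n : ℕ

next : Fin (suc n) → Fin (suc n)
next i with view i
... | ‵fromℕ = zero
... | ‵inj₁ {i = j} _ = suc j

prev : Fin (suc n) → Fin (suc n)
prev zero = fromℕ _
prev (suc j) = inject₁ j

next-fromℕ : ∀ n → next (fromℕ n) ≡ zero
next-fromℕ n rewrite view-fromℕ n = refl

next-inject₁ : (j : Fin n) → next (inject₁ j) ≡ suc j
next-inject₁ j rewrite view-inject₁ j = refl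

next-prev : (i : Fin (suc n)) → next (prev i) ≡ i
next-prev zero = next-fromℕ _
next-prev (suc j) = next-inject₁ j

next-injective : {i j : Fin (suc n)} → next i ≡ next j → i ≡ j
next-injective {i = i} {j} eq with view i | view j
... | ‵fromℕ  | ‵fromℕ  = refl
... | ‵fromℕ  | ‵inj₁ _ = contradiction eq λ ()
... | ‵inj₁ _ | ‵fromℕ  = contradiction eq λ ()
... | ‵inj₁ _ | ‵inj₁ _ = cong inject₁ (Finₚ.suc-injective eq)

next-i≢i : 1 ≤ n → (i : Fin (suc n)) → next i ≢ i
next-i≢i (s≤s z≤n) i with view i
... | ‵fromℕ = λ ()
... | ‵inj₁ {i = j} _ = λ eq → 1+n≢n (trans (cong toℕ eq) (toℕ-inject₁ j))

toℕ-next : (i : Fin (suc n)) → toℕ i < n → toℕ (next i) ≡ suc (toℕ i)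
toℕ-next {n} i i<n with view i
... | ‵fromℕ = contradiction (subst (_< n) (toℕ-fromℕ n) i<n) (<-irrefl refl)
... | ‵inj₁ {i = j} _ = cong suc (sym (toℕ-inject₁ j))

orbit : ℕ → Fin (suc n)
orbit t = fold zero next t

toℕ-orbit : ∀ t → t ≤ n → toℕ (orbit {n} t) ≡ t
toℕ-orbit zero _ = refl
toℕ-orbit (suc t) t<n = trans (toℕ-next (orbit t) (subst (_< _) (sym (toℕ-orbit t (<⇒≤ t<n))) t<n))
                              (cong suc (toℕ-orbit t (<⇒≤ t<n)))

orbit-injective : ∀ {t t′} → t < suc n → t′ < suc n → orbit {n} t ≡ orbit t′ → t ≡ t′
orbit-injective {t = t} {t′} t<1+n t′<1+n eq = begin
  t                ≡⟨ toℕ-orbit t (≤-pred t<1+n) ⟨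
  toℕ (orbit t)    ≡⟨ cong toℕ eq ⟩
  toℕ (orbit t′)   ≡⟨ toℕ-orbit t′ (≤-pred t′<1+n) ⟩
  t′               ∎
  where open ≡-Reasoning

orbit-toℕ : (i : Fin (suc n)) → orbit (toℕ i) ≡ i
orbit-toℕ i = toℕ-injective (toℕ-orbit (toℕ i) (≤-pred (toℕ<n i)))

orbit-period : orbit {n} (suc n) ≡ zero
orbit-period {n} = trans (cong next (toℕ-injective (trans (toℕ-orbit {n} n ≤-refl) (sym (toℕ-fromℕ n)))))
                         (next-fromℕ n)

module _ (P : Fin (suc n) → Set) (P-next : ∀ i → P i → P (next i)) where

  next-closed-from : ∀ {i} → P i → ∀ t → P (fold i next t)
  next-closed-from Pi zero = Pi
  next-closed-from Pi (suc t) = P-next _ (next-closed-from Pi t)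

  next-closed⇒all : ∀ {i} → P i → ∀ j → P j
  next-closed⇒all {i} Pi j = subst P (orbit-toℕ j) (next-closed-from P0 (toℕ j))
    where
    back-to-zero : fold i next (suc n ∸ toℕ i) ≡ zero
    back-to-zero = begin
      fold i next (suc n ∸ toℕ i)                 ≡⟨ cong (λ x → fold x next (suc n ∸ toℕ i)) (orbit-toℕ i) ⟨
      fold (orbit (toℕ i)) next (suc n ∸ toℕ i)   ≡⟨ fold-+ zero next (suc n ∸ toℕ i) ⟨
      orbit (suc n ∸ toℕ i + toℕ i)               ≡⟨ cong orbit (m∸n+n≡m (<⇒≤ (toℕ<n i))) ⟩
      orbit (suc n)                               ≡⟨ orbit-period ⟩
      zero                                        ∎
      where open ≡-Reasoning
    P0 : P zero
    P0 = subst P back-to-zero (next-closed-from Pi (suc n ∸ toℕ i))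

module _ {G : Graph} where

  Joins-sym : ∀ {e x y} → Joins G e x y → Joins G e y x
  Joins-sym (inj₁ eq) = inj₂ eq
  Joins-sym (inj₂ eq) = inj₁ eq

  Joins-endpoint : ∀ {e x y x′ y′} → Joins G e x y → Joins G e x′ y′ → x′ ≡ x ⊎ x′ ≡ y
  Joins-endpoint (inj₁ xy) (inj₁ x′y′) = inj₁ (cong proj₁ (trans (sym x′y′) xy))
  Joins-endpoint (inj₁ xy) (inj₂ y′x′) = inj₂ (cong proj₂ (trans (sym y′x′) xy))
  Joins-endpoint (inj₂ yx) (inj₁ x′y′) = inj₂ (cong proj₁ (trans (sym x′y′) yx))
  Joins-endpoint (inj₂ yx) (inj₂ y′x′) = inj₁ (cong proj₂ (trans (sym y′x′) yx))

  Joins-functional : Loopless G → ∀ {e x y y′} → Joins G e x y → Joins G e x y′ → y ≡ y′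
  Joins-functional _ (inj₁ xy) (inj₁ xy′) = cong proj₂ (trans (sym xy) xy′)
  Joins-functional _ (inj₂ yx) (inj₂ y′x) = cong proj₁ (trans (sym yx) y′x)
  Joins-functional loopless {e} (inj₁ xy) (inj₂ y′x) =
    ⊥-elim (loopless e (trans (cong proj₁ xy) (sym (cong proj₂ y′x))))
  Joins-functional loopless {e} (inj₂ yx) (inj₁ xy′) =
    ⊥-elim (loopless e (trans (cong proj₁ xy′) (sym (cong proj₂ yx))))

  es-joins : (C : Cycle G) (i : Fin (suc (k C))) → Joins G (es C i) (vs C i) (vs C (next i))
  es-joins C i with view i
  ... | ‵fromℕ = close C
  ... | ‵inj₁ {i = j} _ = step C j

  es-endpoint : (C : Cycle G) → ∀ {r x y} → Joins G (es C r) x y → x ≡ vs C r ⊎ x ≡ vs C (next r)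
  es-endpoint C {r} = Joins-endpoint (es-joins C r)

  ∈E⇒∈V : (C : Cycle G) → ∀ {e x y} → e ∈E C → Joins G e x y → x ∈V C
  ∈E⇒∈V C (r , refl) xy with es-endpoint C xy
  ... | inj₁ x≡r = r , sym x≡r
  ... | inj₂ x≡next-r = next r , sym x≡next-r

  endpoint-position : (C : Cycle G) → ∀ {r r′ y} → Joins G (es C r′) (vs C r) y → r ≡ r′ ⊎ r ≡ next r′
  endpoint-position C xy with es-endpoint C xy
  ... | inj₁ eq = inj₁ (vs-inj C eq)
  ... | inj₂ eq = inj₂ (vs-inj C eq)

  edges⊆⇒vertices⊇ : Loopless G → (C D : Cycle G) → (∀ i → es C i ∈E D) → ∀ q → vs D q ∈V C
  edges⊆⇒vertices⊇ loopless C D C⊆D =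
    next-closed⇒all (λ q → vs D q ∈V C) next-∈V {proj₁ start} (zero , proj₂ start)
    where
    start : ∃ λ q → vs C zero ≡ vs D q
    start with ∈E⇒∈V D (C⊆D zero) (es-joins C zero)
    ... | q , eq = q , sym eq

    -- The two edges of C at vs D r are distinct edges of D through vs D r, so one of them is
    -- es D r, and its other end vs D (next r) lies on C.
    next-∈V : ∀ r → vs D r ∈V C → vs D (next r) ∈V C
    next-∈V r (i , Ci≡Dr) = from-positions (endpoint-position D into) (endpoint-position D out)
      where
      t : Fin (suc (k C))
      t = prev i
      r₁ r₂ : Fin (suc (k D))
      r₁ = proj₁ (C⊆D t)
      r₂ = proj₁ (C⊆D i)
      Dr₁≡Ct : es D r₁ ≡ es C t
      Dr₁≡Ct = proj₂ (C⊆D t)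
      Dr₂≡Ci : es D r₂ ≡ es C i
      Dr₂≡Ci = proj₂ (C⊆D i)
      into : Joins G (es D r₁) (vs D r) (vs C t)
      into = subst (λ e → Joins G e (vs D r) (vs C t)) (sym Dr₁≡Ct)
               (Joins-sym (subst (Joins G (es C t) (vs C t)) (trans (cong (vs C) (next-prev i)) Ci≡Dr) (es-joins C t)))
      out : Joins G (es D r₂) (vs D r) (vs C (next i))
      out = subst₂ (λ e x → Joins G e x (vs C (next i))) (sym Dr₂≡Ci) Ci≡Dr (es-joins C i)
      from-positions : r ≡ r₁ ⊎ r ≡ next r₁ → r ≡ r₂ ⊎ r ≡ next r₂ → vs D (next r) ∈V C
      from-positions _ (inj₁ refl) = next i , Joins-functional loopless out (es-joins D r)
      from-positions (inj₁ refl) _ = t , Joins-functional loopless into (es-joins D r)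
      from-positions (inj₂ r≡next-r₁) (inj₂ r≡next-r₂) = ⊥-elim (next-i≢i (k≥1 C) t (trans (next-prev i) (sym t≡i)))
        where
        t≡i : t ≡ i
        t≡i = es-inj C (trans (sym Dr₁≡Ct)
                         (trans (cong (es D) (next-injective (trans (sym r≡next-r₁) r≡next-r₂))) Dr₂≡Ci))

deg≢0⇒incident : (ps : List (Fin n × Fin n)) {v : Fin n} → deg (graph n ps) v ≢ 0
               → ∃ λ p → p ∈ ps × (proj₁ p ≡ v ⊎ proj₂ p ≡ v)
deg≢0⇒incident [] deg≢0 = contradiction refl deg≢0
deg≢0⇒incident ((x , y) ∷ ps) {v} deg≢0 with x ≟ v | y ≟ v
... | yes x≡v | _ = (x , y) , here refl , inj₁ x≡v
... | no _ | yes y≡v = (x , y) , here refl , inj₂ y≡v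
... | no _ | no _ with deg≢0⇒incident ps deg≢0
...   | p , p∈ps , incident = p , there p∈ps , incident

-- Closed trails contain cycles

punchInℕ : ℕ → ℕ → ℕ
punchInℕ zero s = suc s
punchInℕ (suc t) zero = zero
punchInℕ (suc t) (suc s) = suc (punchInℕ t s)

punchInℕ-injective : ∀ t {s s′} → punchInℕ t s ≡ punchInℕ t s′ → s ≡ s′
punchInℕ-injective zero eq = suc-injective eq
punchInℕ-injective (suc t) {zero} {zero} eq = refl
punchInℕ-injective (suc t) {suc s} {suc s′} eq = cong suc (punchInℕ-injective t (suc-injective eq))

punchInℕ-≥ : ∀ {t s} → t ≤ s → punchInℕ t s ≡ suc s
punchInℕ-≥ {zero} _ = refl
punchInℕ-≥ {suc t} {suc s} (s≤s t≤s) = cong suc (punchInℕ-≥ t≤s)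

punchInℕ-≤ : ∀ t s → punchInℕ t s ≤ suc s
punchInℕ-≤ zero s = ≤-refl
punchInℕ-≤ (suc t) zero = z≤n
punchInℕ-≤ (suc t) (suc s) = s≤s (punchInℕ-≤ t s)

punchInℕ-<-reflect : ∀ t s {n} → t ≤ n → punchInℕ t s < suc n → s < n
punchInℕ-<-reflect zero s _ (s≤s lt) = lt
punchInℕ-<-reflect (suc t) zero {suc n} _ _ = z<s
punchInℕ-<-reflect (suc t) (suc s) {suc n} (s≤s t≤n) (s≤s lt) = s≤s (punchInℕ-<-reflect t s t≤n lt)

punchInℕ-surjective : ∀ t {u} → u ≢ t → ∃ λ s → punchInℕ t s ≡ u
punchInℕ-surjective zero {zero} u≢t = contradiction refl u≢t
punchInℕ-surjective zero {suc u} _ = u , refl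
punchInℕ-surjective (suc t) {zero} _ = zero , refl
punchInℕ-surjective (suc t) {suc u} u≢t with punchInℕ-surjective t (u≢t ∘ cong suc)
... | s , eq = suc s , cong suc eq

punchInℕ-pause : ∀ {A : Set} (f : ℕ → A) {t} → f t ≡ f (suc t) → ∀ s → f (punchInℕ (suc t) s) ≡ f (punchInℕ t s)
punchInℕ-pause f {zero} pause zero = pause
punchInℕ-pause f {zero} pause (suc s) = refl
punchInℕ-pause f {suc t} pause zero = refl
punchInℕ-pause f {suc t} pause (suc s) = punchInℕ-pause (f ∘ suc) pause s

module _ (H : Graph) where

  -- A closed walk that may pause (at t ≡ at (suc t)); only its moves use edges, and these are distinct.
  record ClosedTrail (n : ℕ) : Set where
    field
      at             : ℕ → Fin (V H)
      edge           : ∀ t → t < n → at t ≢ at (suc t) → Edge H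
      closed         : at n ≡ at 0
      joins          : ∀ t t<n mv → Joins H (edge t t<n mv) (at t) (at (suc t))
      edge-injective : ∀ {t t′} t<n mv t′<n mv′ → edge t t<n mv ≡ edge t′ t′<n mv′ → t ≡ t′

  open ClosedTrail

  Moving : ∀ {n} → ClosedTrail n → Set
  Moving {n} w = ∃ λ t → t < n × at w t ≢ at w (suc t)

  drop-pause : ∀ {n t} → t < suc n → (w : ClosedTrail (suc n)) → at w t ≡ at w (suc t)
             → Moving w → Σ (ClosedTrail n) Moving
  drop-pause {n} {t} t<1+n w pause (t₀ , t₀<1+n , move) = w′ , moving
    where
    same : ∀ s → at w (punchInℕ (suc t) s) ≡ at w (punchInℕ t s)
    same = punchInℕ-pause (at w) pause
    bound : ∀ {s} → s < n → punchInℕ t s < suc n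
    bound {s} s<n = ≤-<-trans (punchInℕ-≤ t s) (s≤s s<n)
    w′ : ClosedTrail n
    w′ .at s = at w (punchInℕ (suc t) s)
    w′ .edge s s<n mv = edge w (punchInℕ t s) (bound s<n) (mv ∘ trans (same s))
    w′ .closed = trans (same n) (trans (cong (at w) (punchInℕ-≥ (≤-pred t<1+n))) (closed w))
    w′ .joins s s<n mv = subst (λ x → Joins H (w′ .edge s s<n mv) x (at w (suc (punchInℕ t s))))
                               (sym (same s)) (joins w _ (bound s<n) _)
    w′ .edge-injective _ _ _ _ eq = punchInℕ-injective t (edge-injective w _ _ _ _ eq)
    moving : Moving w′
    moving with punchInℕ-surjective t {t₀} (λ { refl → move pause })
    ... | s , refl = s , punchInℕ-<-reflect t s (≤-pred t<1+n) t₀<1+n , move ∘ trans (sym (same s))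

  shortcut : ∀ {n i j} → i < j → j < n → (w : ClosedTrail n) → at w i ≡ at w j → at w i ≢ at w (suc i)
           → Σ (ClosedTrail (j ∸ i)) Moving
  shortcut {n} {i} {j} i<j j<n w loop move = w′ , (0 , m<n⇒0<n∸m i<j , move)
    where
    j∸i+i≡j : j ∸ i + i ≡ j
    j∸i+i≡j = m∸n+n≡m (<⇒≤ i<j)
    bound : ∀ {s} → s < j ∸ i → s + i < n
    bound s<j∸i = <-trans (subst (_ <_) j∸i+i≡j (+-monoˡ-< i s<j∸i)) j<n
    w′ : ClosedTrail (j ∸ i)
    w′ .at s = at w (s + i)
    w′ .edge s s<j∸i = edge w (s + i) (bound s<j∸i)
    w′ .closed = trans (cong (at w) j∸i+i≡j) (sym loop)
    w′ .joins s s<j∸i = joins w (s + i) (bound s<j∸i)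
    w′ .edge-injective _ _ _ _ eq = +-cancelʳ-≡ _ _ _ (edge-injective w _ _ _ _ eq)

  simple-trail⇒cycle : ∀ {n} (w : ClosedTrail n) → Moving w
                     → (∀ t → t < n → at w t ≢ at w (suc t))
                     → (∀ {i j} → i < j → j < n → at w i ≢ at w j)
                     → Cycle H
  simple-trail⇒cycle {zero} w (_ , () , _)
  simple-trail⇒cycle {suc zero} w _ no-pause _ = contradiction (sym (closed w)) (no-pause 0 z<s)
  simple-trail⇒cycle {suc (suc m)} w _ no-pause no-repeat = record
    { k      = suc m
    ; k≥1    = s≤s z≤n
    ; vs     = λ x → at w (toℕ x)
    ; es     = λ x → edge w (toℕ x) (toℕ<n x) (no-pause (toℕ x) (toℕ<n x))
    ; vs-inj = vs-injective
    ; es-inj = λ eq → toℕ-injective (edge-injective w _ _ _ _ eq)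
    ; step   = λ i → joins-toℕ (toℕ-inject₁ i)
    ; close  = subst (Joins H _ _) (closed w) (joins-toℕ (toℕ-fromℕ (suc m)))
    }
    where
    joins-toℕ : ∀ {x : Fin (suc (suc m))} {t} → toℕ x ≡ t
              → Joins H (edge w (toℕ x) (toℕ<n x) (no-pause (toℕ x) (toℕ<n x))) (at w (toℕ x)) (at w (suc t))
    joins-toℕ refl = joins w _ _ _
    vs-injective : ∀ {x y : Fin (suc (suc m))} → at w (toℕ x) ≡ at w (toℕ y) → x ≡ y
    vs-injective {x} {y} eq with <-cmp (toℕ x) (toℕ y)
    ... | tri< x<y _ _ = contradiction eq (no-repeat x<y (toℕ<n y))
    ... | tri≈ _ x≡y _ = toℕ-injective x≡y
    ... | tri> _ _ y<x = contradiction (sym eq) (no-repeat y<x (toℕ<n x))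

  moving-trail⇒cycle : ∀ n (w : ClosedTrail n) → Moving w → Cycle H
  moving-trail⇒cycle = <-rec _ extract
    where
    extract : ∀ n → (∀ {m} → m < n → (w : ClosedTrail m) → Moving w → Cycle H)
            → (w : ClosedTrail n) → Moving w → Cycle H
    extract zero _ w (_ , () , _)
    extract (suc n) rec w mv with anyUpTo? (λ t → at w t ≟ at w (suc t)) (suc n)
    ... | yes (t , t<1+n , pause) = uncurry (rec ≤-refl) (drop-pause t<1+n w pause mv)
    ... | no no-pause with anyUpTo? (λ j → anyUpTo? (λ i → at w i ≟ at w j) j) (suc n)
    ...   | yes (j , j<1+n , i , i<j , loop) =
            uncurry (rec (≤-<-trans (m∸n≤m j i) j<1+n))
                    (shortcut i<j j<1+n w loop (λ p → no-pause (i , <-trans i<j j<1+n , p)))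
    ...   | no no-repeat =
            simple-trail⇒cycle w mv (λ t t<1+n p → no-pause (t , t<1+n , p))
                                     (λ i<j j<1+n loop → no-repeat (_ , j<1+n , _ , i<j , loop))

-- The cycle intersection graph

lookup-map : ∀ {A B : Set} (f : A → B) (ys : List A) (i : Fin (length (map f ys)))
           → lookup (map f ys) i ≡ f (lookup ys (cast (length-map f ys) i))
lookup-map f (y ∷ ys) zero = refl
lookup-map f (y ∷ ys) (suc i) = lookup-map f ys i

lookup-≡-map : ∀ {A B : Set} (f : A → B) {xs ys} (xs≡ : xs ≡ map f ys) (i : Fin (length xs))
             → lookup xs i ≡ f (lookup ys (cast (trans (cong length xs≡) (length-map f ys)) i))
lookup-≡-map f {ys = ys} refl = lookup-map f ys

T-does⁺ : ∀ {A : Set} (a? : Dec A) → A → T (does a?)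
T-does⁺ a? a = Equivalence.from T-≡ (dec-true a? a)

T-does⁻ : ∀ {A : Set} (a? : Dec A) → T (does a?) → A
T-does⁻ (yes a) _  = a
T-does⁻ (no _)  ()

module _ {G : Graph} {v : Fin (V G)} (C : Cycle G) where

  ∈V⇒inCycleᵇ : v ∈V C → T (inCycleᵇ v C)
  ∈V⇒inCycleᵇ = T-does⁺ (Finₚ.any? (λ i → vs C i ≟ v))

  inCycleᵇ⇒∈V : T (inCycleᵇ v C) → v ∈V C
  inCycleᵇ⇒∈V = T-does⁻ (Finₚ.any? (λ i → vs C i ≟ v))

module _ {G : Graph} (𝒞 : CycleDecomposition G) where

  private
    CIG : Graph
    CIG = CI G 𝒞

    Shares : Fin (c 𝒞) → Fin (c 𝒞) → Fin (V G) → Bool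
    Shares i j v = (toℕ i <ᵇ toℕ j) ∧ inCycleᵇ v (cyc 𝒞 i) ∧ inCycleᵇ v (cyc 𝒞 j)

    sharedBy : Fin (c 𝒞) → Fin (c 𝒞) → List (Fin (V G))
    sharedBy i j = filterᵇ (Shares i j) (allFin (V G))

    labelledFrom : Fin (c 𝒞) → Fin (c 𝒞) → List ((Fin (c 𝒞) × Fin (c 𝒞)) × Fin (V G))
    labelledFrom i j = map ((i , j) ,_) (sharedBy i j)

    labelledFromᵢ : Fin (c 𝒞) → List ((Fin (c 𝒞) × Fin (c 𝒞)) × Fin (V G))
    labelledFromᵢ i = concatMap (labelledFrom i) (allFin (c 𝒞))

  -- The edges of CI, each tagged with the common vertex of the two cycles that it stands for.
  labelledEdges : List ((Fin (c 𝒞) × Fin (c 𝒞)) × Fin (V G))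
  labelledEdges = concatMap labelledFromᵢ (allFin (c 𝒞))

  E-CI : E CIG ≡ map proj₁ labelledEdges
  E-CI = sym (begin
    map proj₁ (concatMap labelledFromᵢ (allFin (c 𝒞)))
      ≡⟨ map-concatMap proj₁ labelledFromᵢ (allFin (c 𝒞)) ⟩
    concatMap (map proj₁ ∘ labelledFromᵢ) (allFin (c 𝒞))
      ≡⟨ concatMap-cong (λ i → map-concatMap proj₁ (labelledFrom i) (allFin (c 𝒞))) (allFin (c 𝒞)) ⟩
    concatMap (λ i → concatMap (map proj₁ ∘ labelledFrom i) (allFin (c 𝒞))) (allFin (c 𝒞))
      ≡⟨ concatMap-cong (λ i → concatMap-cong (λ j → sym (map-∘ (sharedBy i j))) (allFin (c 𝒞))) (allFin (c 𝒞)) ⟩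
    E CIG ∎)
    where open ≡-Reasoning

  ∈labelledEdges⁺ : ∀ {i j v} → toℕ i < toℕ j → v ∈V cyc 𝒞 i → v ∈V cyc 𝒞 j → ((i , j) , v) ∈ labelledEdges
  ∈labelledEdges⁺ {i} {j} {v} i<j v∈i v∈j =
    ∈-concatMap⁺ labelledFromᵢ (lose (∈-allFin i) (∈-concatMap⁺ (labelledFrom i) (lose (∈-allFin j)
      (∈-map⁺ ((i , j) ,_) (∈-filter⁺ (T? ∘ Shares i j) (∈-allFin v) shares)))))
    where
    shares : T (Shares i j v)
    shares = Equivalence.from T-∧
      (<⇒<ᵇ i<j , Equivalence.from T-∧ (∈V⇒inCycleᵇ (cyc 𝒞 i) v∈i , ∈V⇒inCycleᵇ (cyc 𝒞 j) v∈j))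

  ∈labelledEdges⁻ : ∀ {i j v} → ((i , j) , v) ∈ labelledEdges → v ∈V cyc 𝒞 i × v ∈V cyc 𝒞 j
  ∈labelledEdges⁻ x∈ with satisfied (∈-concatMap⁻ labelledFromᵢ {xs = allFin (c 𝒞)} x∈)
  ... | i , x∈ᵢ with satisfied (∈-concatMap⁻ (labelledFrom i) {xs = allFin (c 𝒞)} x∈ᵢ)
  ... | j , x∈ᵢⱼ with ∈-map⁻ ((i , j) ,_) x∈ᵢⱼ
  ... | v , v∈ , refl
    with Equivalence.to (T-∧ {toℕ i <ᵇ toℕ j}) (proj₂ (∈-filter⁻ (T? ∘ Shares i j) {xs = allFin (V G)} v∈))
  ... | _ , shared with Equivalence.to (T-∧ {inCycleᵇ v (cyc 𝒞 i)}) shared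
  ... | v∈i , v∈j = inCycleᵇ⇒∈V (cyc 𝒞 i) v∈i , inCycleᵇ⇒∈V (cyc 𝒞 j) v∈j

  private
    length-E-CI : length (E CIG) ≡ length labelledEdges
    length-E-CI = trans (cong length E-CI) (length-map proj₁ labelledEdges)

  labelledEdge : Edge CIG → (Fin (c 𝒞) × Fin (c 𝒞)) × Fin (V G)
  labelledEdge e = lookup labelledEdges (cast length-E-CI e)

  label : Edge CIG → Fin (V G)
  label e = proj₂ (labelledEdge e)

  ends-labelledEdge : ∀ e → ends CIG e ≡ proj₁ (labelledEdge e)
  ends-labelledEdge = lookup-≡-map proj₁ E-CI

  label-∈V : ∀ e → label e ∈V cyc 𝒞 (proj₁ (ends CIG e)) × label e ∈V cyc 𝒞 (proj₂ (ends CIG e))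
  label-∈V e rewrite ends-labelledEdge e = ∈labelledEdges⁻ (∈-lookup (cast length-E-CI e))

  ∈labelledEdges⇒edge : ∀ {x} → x ∈ labelledEdges → ∃ λ e → labelledEdge e ≡ x
  ∈labelledEdges⇒edge x∈ = cast (sym length-E-CI) (index x∈) , (begin
    lookup labelledEdges (cast length-E-CI (cast (sym length-E-CI) (index x∈)))
      ≡⟨ cong (lookup labelledEdges) (cast-involutive length-E-CI (sym length-E-CI) (index x∈)) ⟩
    lookup labelledEdges (index x∈)
      ≡⟨ lookup-index x∈ ⟨
    _ ∎)
    where open ≡-Reasoning

  CI-edge : ∀ {a b w} → a ≢ b → w ∈V cyc 𝒞 a → w ∈V cyc 𝒞 b → ∃ λ e → Joins CIG e a b × label e ≡ w
  CI-edge {a} {b} a≢b w∈a w∈b with <-cmp (toℕ a) (toℕ b)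
  ... | tri< a<b _ _ =
    let e , e≡ = ∈labelledEdges⇒edge (∈labelledEdges⁺ a<b w∈a w∈b)
    in e , inj₁ (trans (ends-labelledEdge e) (cong proj₁ e≡)) , cong proj₂ e≡
  ... | tri≈ _ a≡b _ = contradiction (toℕ-injective a≡b) a≢b
  ... | tri> _ _ b<a =
    let e , e≡ = ∈labelledEdges⇒edge (∈labelledEdges⁺ b<a w∈b w∈a)
    in e , inj₂ (trans (ends-labelledEdge e) (cong proj₁ e≡)) , cong proj₂ e≡

module _ {G : Graph} (𝒞 : CycleDecomposition G) where

  colour : Edge G → Fin (c 𝒞)
  colour e = proj₁ (cover 𝒞 e)

  colourAt : (C : Cycle G) → ℕ → Fin (c 𝒞)
  colourAt C t = colour (es C (orbit t))

  colour-change : (C : Cycle G) → ∀ t → colourAt C t ≢ colourAt C (suc t)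
                → ∃ λ e → Joins (CI G 𝒞) e (colourAt C t) (colourAt C (suc t)) × label 𝒞 e ≡ vs C (orbit (suc t))
  colour-change C t change = CI-edge 𝒞 change
    (∈E⇒∈V (cyc 𝒞 _) (proj₂ (cover 𝒞 _)) (Joins-sym {G = G} (es-joins C (orbit t))))
    (∈E⇒∈V (cyc 𝒞 _) (proj₂ (cover 𝒞 _)) (es-joins C (orbit (suc t))))

  colourTrail : (C : Cycle G) → ClosedTrail (CI G 𝒞) (suc (k C))
  colourTrail C = record
    { at             = colourAt C
    ; edge           = λ t _ change → proj₁ (colour-change C t change)
    ; closed         = cong (colour ∘ es C) orbit-period
    ; joins          = λ t _ change → proj₁ (proj₂ (colour-change C t change))
    ; edge-injective = λ {t} {t′} t<n change t′<n change′ eq →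
        orbit-injective t<n t′<n (next-injective (vs-inj C (label-injective {t} {t′} change change′ eq)))
    }
    where
    label-injective : ∀ {t t′} change change′
                    → proj₁ (colour-change C t change) ≡ proj₁ (colour-change C t′ change′)
                    → vs C (orbit (suc t)) ≡ vs C (orbit (suc t′))
    label-injective {t} {t′} change change′ eq = begin
      vs C (orbit (suc t))                          ≡⟨ proj₂ (proj₂ (colour-change C t change)) ⟨
      label 𝒞 (proj₁ (colour-change C t change))    ≡⟨ cong (label 𝒞) eq ⟩
      label 𝒞 (proj₁ (colour-change C t′ change′))  ≡⟨ proj₂ (proj₂ (colour-change C t′ change′)) ⟩
      vs C (orbit (suc t′))                         ∎
      where open ≡-Reasoning

cycle-covers-decomposition-cycle : ∀ {G} → Loopless G → (𝒞 : CycleDecomposition G) → Acyclic (CI G 𝒞)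
                                 → (C : Cycle G) → ∃ λ a → ∀ q → vs (cyc 𝒞 a) q ∈V C
cycle-covers-decomposition-cycle loopless 𝒞 acyclic C = a₀ , edges⊆⇒vertices⊇ loopless C (cyc 𝒞 a₀) C⊆Cₐ₀
  where
  a₀ : Fin (c 𝒞)
  a₀ = colourAt 𝒞 C 0
  constant : ∀ t → t ≤ suc (k C) → colourAt 𝒞 C t ≡ a₀
  constant zero _ = refl
  constant (suc t) t<1+k with colourAt 𝒞 C t ≟ colourAt 𝒞 C (suc t)
  ... | yes same = trans (sym same) (constant t (<⇒≤ t<1+k))
  ... | no change = ⊥-elim (acyclic (moving-trail⇒cycle _ _ (colourTrail 𝒞 C) (t , t<1+k , change)))
  colour≡a₀ : ∀ i → colour 𝒞 (es C i) ≡ a₀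
  colour≡a₀ i = trans (cong (colour 𝒞 ∘ es C) (sym (orbit-toℕ i))) (constant (toℕ i) (<⇒≤ (toℕ<n i)))
  C⊆Cₐ₀ : ∀ i → es C i ∈E cyc 𝒞 a₀
  C⊆Cₐ₀ i = subst (λ a → es C i ∈E cyc 𝒞 a) (colour≡a₀ i) (proj₂ (cover 𝒞 (es C i)))

-- A decycling set from a spanning subgraph of CI

∣p∪q∣≤∣p∣+∣q∣ : (p q : Subset n) → ∣ p ∪ q ∣ ≤ ∣ p ∣ + ∣ q ∣
∣p∪q∣≤∣p∣+∣q∣ [] [] = z≤n
∣p∪q∣≤∣p∣+∣q∣ (true ∷ p) (y ∷ q) = s≤s (≤-trans (∣p∪q∣≤∣p∣+∣q∣ p q) (+-monoʳ-≤ ∣ p ∣ (∣p∣≤∣x∷p∣ y q)))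
∣p∪q∣≤∣p∣+∣q∣ (false ∷ p) (true ∷ q) = subst (suc ∣ p ∪ q ∣ ≤_) (sym (+-suc ∣ p ∣ ∣ q ∣)) (s≤s (∣p∪q∣≤∣p∣+∣q∣ p q))
∣p∪q∣≤∣p∣+∣q∣ (false ∷ p) (false ∷ q) = ∣p∪q∣≤∣p∣+∣q∣ p q

∣⋃⁅⁆∣≤length : (xs : List (Fin n)) → ∣ ⋃ (map ⁅_⁆ xs) ∣ ≤ length xs
∣⋃⁅⁆∣≤length {n} [] = ≤-reflexive (∣⊥∣≡0 n)
∣⋃⁅⁆∣≤length (x ∷ xs) = begin
  ∣ ⁅ x ⁆ ∪ ⋃ (map ⁅_⁆ xs) ∣         ≤⟨ ∣p∪q∣≤∣p∣+∣q∣ ⁅ x ⁆ _ ⟩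
  ∣ ⁅ x ⁆ ∣ + ∣ ⋃ (map ⁅_⁆ xs) ∣     ≡⟨ cong (_+ _) (∣⁅x⁆∣≡1 x) ⟩
  suc ∣ ⋃ (map ⁅_⁆ xs) ∣             ≤⟨ s≤s (∣⋃⁅⁆∣≤length xs) ⟩
  suc (length xs)                    ∎
  where open ≤-Reasoning

∈⇒∈⋃⁅⁆ : ∀ {x : Fin n} {xs} → x ∈ xs → x ∈ₛ ⋃ (map ⁅_⁆ xs)
∈⇒∈⋃⁅⁆ (here refl) = x∈p∪q⁺ (inj₁ (x∈⁅x⁆ _))
∈⇒∈⋃⁅⁆ (there x∈xs) = x∈p∪q⁺ (inj₂ (∈⇒∈⋃⁅⁆ x∈xs))

module _ {G : Graph} (𝒞 : CycleDecomposition G) (T : Subset (length (E (CI G 𝒞)))) where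

  private
    F : Graph
    F = spanningSub (CI G 𝒞) T
    edgesOfF : List (Edge (CI G 𝒞))
    edgesOfF = filterᵇ (λ e → does (e ∈? T)) (allFin (length (E (CI G 𝒞))))
    isolated : List (Fin (c 𝒞))
    isolated = filterᵇ (λ a → does (deg F a ℕ.≟ 0)) (allFin (c 𝒞))
    some-vertex : Fin (c 𝒞) → Fin (V G)
    some-vertex a = vs (cyc 𝒞 a) zero
    representatives : List (Fin (V G))
    representatives = map (label 𝒞) edgesOfF ++ map some-vertex isolated

  transversal : Subset (V G)
  transversal = ⋃ (map ⁅_⁆ representatives)

  ∣transversal∣≤forestSize : ∣ transversal ∣ ≤ forestSize F
  ∣transversal∣≤forestSize = begin
    ∣ transversal ∣                                 ≤⟨ ∣⋃⁅⁆∣≤length representatives ⟩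
    length representatives                          ≡⟨ length-++ (map (label 𝒞) edgesOfF) ⟩
    length (map (label 𝒞) edgesOfF) + length (map some-vertex isolated)
                                                    ≡⟨ cong₂ _+_ (length-map (label 𝒞) edgesOfF) (length-map some-vertex isolated) ⟩
    length edgesOfF + length isolated               ≡⟨ cong (_+ length isolated) (length-map (ends (CI G 𝒞)) edgesOfF) ⟨
    forestSize F                                    ∎
    where open ≤-Reasoning

  transversal-meets : ∀ a → ∃ λ q → vs (cyc 𝒞 a) q ∈ₛ transversal
  transversal-meets a with deg F a ℕ.≟ 0
  ... | yes deg≡0 = zero , ∈⇒∈⋃⁅⁆ (∈-++⁺ʳ (map (label 𝒞) edgesOfF) (∈-map⁺ some-vertex a∈isolated))
    where
    a∈isolated : a ∈ isolated
    a∈isolated = ∈-filter⁺ (λ b → T? (does (deg F b ℕ.≟ 0))) (∈-allFin a) (T-does⁺ (deg F a ℕ.≟ 0) deg≡0)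
  ... | no deg≢0 with deg≢0⇒incident (E F) deg≢0
  ...   | p , p∈F , incident with ∈-map⁻ (ends (CI G 𝒞)) p∈F
  ...     | e , e∈F , refl = on-cycle incident
    where
    label∈S : label 𝒞 e ∈ₛ transversal
    label∈S = ∈⇒∈⋃⁅⁆ (∈-++⁺ˡ (∈-map⁺ (label 𝒞) e∈F))
    on-cycle : proj₁ (ends (CI G 𝒞) e) ≡ a ⊎ proj₂ (ends (CI G 𝒞) e) ≡ a → ∃ λ q → vs (cyc 𝒞 a) q ∈ₛ transversal
    on-cycle (inj₁ refl) = let q , q≡ = proj₁ (label-∈V 𝒞 e) in q , subst (_∈ₛ transversal) (sym q≡) label∈S
    on-cycle (inj₂ refl) = let q , q≡ = proj₂ (label-∈V 𝒞 e) in q , subst (_∈ₛ transversal) (sym q≡) label∈S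

transversal-decycling : ∀ {G} → Loopless G → (𝒞 : CycleDecomposition G) → Acyclic (CI G 𝒞)
                      → ∀ T → Decycling G (transversal 𝒞 T)
transversal-decycling loopless 𝒞 acyclic T C
  with cycle-covers-decomposition-cycle loopless 𝒞 acyclic C
... | a , Cₐ⊆C with transversal-meets 𝒞 T a
...   | q , q∈S with Cₐ⊆C q
...     | i , i≡q = i , subst (_∈ₛ transversal 𝒞 T) (sym i≡q) q∈S

lemma2 : (G : Graph) → Loopless G → Connected G → Even G
       → (𝒞 : CycleDecomposition G) → Tree (CI G 𝒞)
       → (d m : ℕ) → IsDecyclingNumber G d → IsMSFSize (CI G 𝒞) m
       → d ≤ m
lemma2 G loopless _ _ 𝒞 (_ , acyclic) d m (_ , d≤decycling) ((T , _ , size≡m) , _) = begin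
  d                                   ≤⟨ d≤decycling _ (transversal-decycling loopless 𝒞 acyclic T) ⟩
  ∣ transversal 𝒞 T ∣                 ≤⟨ ∣transversal∣≤forestSize 𝒞 T ⟩
  forestSize (spanningSub (CI G 𝒞) T) ≡⟨ size≡m ⟩
  m                                   ∎
  where open ≤-Reasoning
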